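{- Let $n\ge1$ and write $\mathrm{key}_m=0^l(\sigma+1)w$ ($l\ge0$, $\sigma$ a symbol). If $\mathrm{first}(C_r)$ is the immediate successor of $\mathrm{last}(C_m)$ in $D(n,k)$ (for some $k$ with $m,r<c(n,k)$), then $\mathrm{key}_r=0^l(\sigma+2)w$.
   Context: Words are over $\mathbb N$; $\sigma^t$ denotes $t$ repetitions of $\sigma$. A rotation of $xy$ is $yx$. For words of equal length, $w_1\le_{\mathrm{colex}} w_2$ means the reversal of $w_1$ is lexicographically $\le$ the reversal of $w_2$. A key-word is a length-$n$ word colex-maximal among its rotations. For $k\ge1$ let $c(n,k)$ be the number of key-words in $[k]^n$ ($[k]=\{0,\dots,k-1\}$), listed in increasing colex order $\mathrm{key}_0<\cdots<\mathrm{key}_{c(n,k)-1}$ (consistently in $k$). Cycles: $C_0=(0^n)$. For $m\ge1$ write $\mathrm{key}_m=0^l(\sigma+1)w$; $C_m$ is the sequence of all distinct rotations of $\mathrm{key}_m$, starting with $\mathrm{first}(C_m)=w0^l(\sigma+1)$, in which each word $\tau w'$ is followed by $w'\tau$, ending with $\mathrm{last}(C_m)=(\sigma+1)w0^l$. Construction: $D_0=(0^n)$; writing $\mathrm{key}_{m+1}=0^l(\sigma+1)w$, $D_{m+1}$ is obtained from $D_m$ by inserting the sequence $C_{m+1}$ immediately after the word $\sigma w0^l$ of $D_m$. $D(n,k)=D_{c(n,k)-1}$. -}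

module Defs where

open import Data.Nat using (ℕ; zero; suc; _<ᵇ_; _≡ᵇ_; _∸_)
import Data.Nat as ℕ
open import Data.Bool using (Bool; true; false; if_then_else_; _∧_)
open import Data.List using (List; []; _∷_; _++_; [_]; map; reverse; replicate;
  concatMap; upTo; filterᵇ; length; foldr)
open import Data.List.Properties using (≡-dec)
open import Data.Maybe using (Maybe; just; nothing)
open import Data.Product using (_×_; _,_; ∃)
open import Relation.Nullary using (does)
open import Relation.Binary.PropositionalEquality using (_≡_)

Word : Set
Word = List ℕ

_==w_ : Word → Word → Bool
u ==w v = does (≡-dec ℕ._≟_ u v)

rotl : Word → Word
rotl []       = []
rotl (x ∷ xs) = xs ++ [ x ]

rotl^ : ℕ → Word → Word
rotl^ zero    w = w
rotl^ (suc i) w = rotl^ i (rotl w)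

-- lexicographic ≤ (used on words of equal length)
lexLeq : Word → Word → Bool
lexLeq []       _        = true
lexLeq (x ∷ xs) []       = false
lexLeq (x ∷ xs) (y ∷ ys) =
  if x <ᵇ y then true else (if x ≡ᵇ y then lexLeq xs ys else false)

colexLeq : Word → Word → Bool
colexLeq u v = lexLeq (reverse u) (reverse v)

isKey : Word → Bool
isKey w = foldr (λ i b → colexLeq (rotl^ i w) w ∧ b) true (upTo (length w))

lexWords : ℕ → ℕ → List Word
lexWords zero    k = [ [] ]
lexWords (suc n) k = concatMap (λ a → map (a ∷_) (lexWords n k)) (upTo k)

colexWords : ℕ → ℕ → List Word
colexWords n k = map reverse (lexWords n k)

keys : ℕ → ℕ → List Word
keys n k = filterᵇ isKey (colexWords n k)

c : ℕ → ℕ → ℕ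
c n k = length (keys n k)

-- list indexing with a default (only used for in-range indices)
nth : Word → List Word → ℕ → Word
nth d []       _       = d
nth d (x ∷ xs) zero    = x
nth d (x ∷ xs) (suc i) = nth d xs i

key : ℕ → ℕ → ℕ → Word
key n k m = nth [] (keys n k) m

-- decomposition  u = 0^l (σ+1) w  ↦  (l , σ , w)   (nothing if u = 0^n)
decomp : Word → Maybe (ℕ × ℕ × Word)
decomp []            = nothing
decomp (zero ∷ xs)   with decomp xs
... | nothing            = nothing
... | just (l , s , w)   = just (suc l , s , w)
decomp (suc s ∷ xs)  = just (zero , s , xs)

-- number of distinct rotations of u = least p ≥ 1 with rotl^p u = u
minPer : Word → List ℕ → ℕ → ℕ
minPer u []       d = d
minPer u (p ∷ ps) d = if rotl^ p u ==w u then p else minPer u ps d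

period : Word → ℕ
period u = minPer u (map suc (upTo (length u))) (length u)

-- the cycle C of a key-word:  C(0^n) = (0^n);  for u = 0^l(σ+1)w,
-- the distinct rotations of u, starting at w0^l(σ+1), each τw' followed by w'τ
cycleOf : Word → List Word
cycleOf u with decomp u
... | nothing          = [ u ]
... | just (l , s , w) =
  map (λ i → rotl^ i (w ++ replicate l 0 ++ [ suc s ])) (upTo (period u))

C : ℕ → ℕ → ℕ → List Word
C n k m = cycleOf (key n k m)

headD : Word → List Word → Word
headD d []      = d
headD d (x ∷ _) = x

lastD : Word → List Word → Word
lastD d []       = d
lastD d (x ∷ xs) = lastD x xs

firstC lastC : ℕ → ℕ → ℕ → Word
firstC n k m = headD [] (C n k m)
lastC  n k m = lastD [] (C n k m)

insertAfter : Word → List Word → List Word → List Word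
insertAfter x ys []       = []
insertAfter x ys (z ∷ zs) =
  if z ==w x then z ∷ (ys ++ zs) else z ∷ insertAfter x ys zs

anchor : Word → Word
anchor u with decomp u
... | nothing          = u
... | just (l , s , w) = s ∷ (w ++ replicate l 0)

Dm : ℕ → ℕ → ℕ → List Word
Dm n k zero    = [ replicate n 0 ]
Dm n k (suc m) = insertAfter (anchor (key n k (suc m))) (C n k (suc m)) (Dm n k m)

D : ℕ → ℕ → List Word
D n k = Dm n k (c n k ∸ 1)

ImmSucc : Word → Word → List Word → Set
ImmSucc x y xs = ∃ λ pre → ∃ λ post → xs ≡ pre ++ (x ∷ y ∷ post)

-- Inserting C_{j+1} after the anchor σw0^l of key_{j+1} = 0^l(σ+1)w creates only three kinds
-- of adjacent pairs: (anchor, first C_{j+1}), pairs inside C_{j+1}, and (last C_{j+1}, y) for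
-- the old successor y of the anchor.  Two key-words that are rotations of each other coincide
-- (colex antisymmetry), so every word y is a rotation of exactly one key_a.  By induction on j,
-- whenever y follows x in D_j and y = first C_a, x is the anchor of key_a: first C_a does not
-- recur inside C_a, whose length is the minimal period, and in the third case the anchors of
-- key_a and key_{j+1} would agree, which forces equal first rotations w0^l(σ+1), hence a = j+1,
-- although y already lay in D_j.
-- For last C_m = (σ+1)w0^l followed by first C_r this says key_r = 0^l'(σ+2)w' with
-- w'0^l' = w0^l.  In a key-word 0^l(σ+1)w the part w does not end in 0 (else the rotation
-- w0^l(σ+1) would be colex-larger), so w' = w and l' = l.

module Submission where

open import Defs
open import Data.Bool using (Bool; true; false; T; _∧_)
open import Data.Bool.ListAction using (all)
open import Data.Empty using (⊥; ⊥-elim)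
open import Data.List
  using (List; []; _∷_; _++_; [_]; map; reverse; replicate; length; upTo; applyUpTo; iterate;
         head; concatMap; cartesianProductWith)
open import Data.List.Membership.Propositional using (_∈_)
open import Data.List.Membership.Propositional.Properties
  using (∈-filter⁻; ∈-map⁻; ∈-cartesianProductWith⁻)
open import Data.List.Properties
  using (≡-dec; ++-assoc; ++-identityʳ; ++-conicalʳ; ∷-injective; ∷-injectiveʳ; ∷ʳ-injective; foldr-map;
         map-upTo; reverse-++; reverse-injective; unfold-reverse; length-reverse; filter-accept)
open import Data.List.Relation.Unary.All using (All; []; _∷_) renaming (lookup to All-lookup)
open import Data.List.Relation.Unary.AllPairs using ([]; _∷_)
open import Data.List.Relation.Unary.All.Properties using (all⁺; all⁻; applyUpTo⁻; applyUpTo⁺₂; map⁺)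
open import Data.List.Relation.Unary.Any using (here; there)
open import Data.List.Relation.Unary.Unique.Propositional using (Unique)
import Data.List.Relation.Unary.Unique.Propositional.Properties as Unique
open import Data.Maybe using (just; nothing)
open import Data.Nat using (ℕ; zero; suc; _+_; _*_; _∸_; _≤_; _<_; _<ᵇ_; _≡ᵇ_; z≤n; s≤s)
import Data.Nat as ℕ
open import Data.Nat.DivMod using (_%_; _/_; m≡m%n+[m/n]*n; m%n<n)
open import Data.Nat.Properties
  using (<ᵇ-reflects-<; n<1+n; ≡ᵇ⇒≡; ≡⇒≡ᵇ; <-asym; <-irrefl; +-comm; +-suc; *-suc; ≤-refl; ≤-trans;
         n≤1+n; m≤n⇒m≤1+n; ≤-reflexive; +-identityʳ; m≤n⇒m<n∨m≡n; ≤-<-trans; <-≤-trans; <-trans)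
open import Data.Product using (_×_; _,_; ∃-syntax; proj₁; proj₂)
open import Data.Sum using (_⊎_; inj₁; inj₂)
open import Data.Unit using (⊤)
open import Function using (id; _∘_)
open import Relation.Nullary using (yes; no)
open import Relation.Nullary.Decidable using (T?)
open import Relation.Nullary.Reflects using (ofʸ)
open import Relation.Binary.PropositionalEquality
  using (_≡_; _≢_; refl; sym; trans; cong; cong₂; subst; module ≡-Reasoning)

lexLeq-∷⁻ : ∀ {x y xs ys} → T (lexLeq (x ∷ xs) (y ∷ ys)) → x < y ⊎ (x ≡ y × T (lexLeq xs ys))
lexLeq-∷⁻ {x} {y} p with x <ᵇ y | <ᵇ-reflects-< x y
... | true  | ofʸ x<y = inj₁ x<y
... | false | _ with x ≡ᵇ y | ≡ᵇ⇒≡ x y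
...   | true | x≡y = inj₂ (x≡y _ , p)

lexLeq-refl : ∀ xs → T (lexLeq xs xs)
lexLeq-refl []       = _
lexLeq-refl (x ∷ xs) with x <ᵇ x | <ᵇ-reflects-< x x
... | true  | ofʸ x<x = ⊥-elim (<-irrefl refl x<x)
... | false | _ with x ≡ᵇ x | ≡⇒≡ᵇ x x refl
...   | true | _ = lexLeq-refl xs

lexLeq-antisym : ∀ xs ys → T (lexLeq xs ys) → T (lexLeq ys xs) → xs ≡ ys
lexLeq-antisym []       []       _ _ = refl
lexLeq-antisym (x ∷ xs) (y ∷ ys) p q
  with lexLeq-∷⁻ {x} {y} {xs} {ys} p | lexLeq-∷⁻ {y} {x} {ys} {xs} q
... | inj₁ x<y        | inj₁ y<x        = ⊥-elim (<-asym x<y y<x)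
... | inj₁ x<y        | inj₂ (refl , _) = ⊥-elim (<-irrefl refl x<y)
... | inj₂ (refl , _) | inj₁ y<x        = ⊥-elim (<-irrefl refl y<x)
... | inj₂ (refl , p) | inj₂ (_ , q)    = cong (x ∷_) (lexLeq-antisym xs ys p q)

colexLeq-antisym : ∀ u v → T (colexLeq u v) → T (colexLeq v u) → u ≡ v
colexLeq-antisym u v p q = reverse-injective (lexLeq-antisym (reverse u) (reverse v) p q)

-- Rotations
rotl^-+ : ∀ a b u → rotl^ (a + b) u ≡ rotl^ b (rotl^ a u)
rotl^-+ zero    b u = refl
rotl^-+ (suc a) b u = rotl^-+ a b (rotl u)

rotl^-comm : ∀ a b u → rotl^ a (rotl^ b u) ≡ rotl^ b (rotl^ a u)
rotl^-comm a b u = begin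
  rotl^ a (rotl^ b u) ≡⟨ rotl^-+ b a u ⟨
  rotl^ (b + a) u     ≡⟨ cong (λ i → rotl^ i u) (+-comm b a) ⟩
  rotl^ (a + b) u     ≡⟨ rotl^-+ a b u ⟩
  rotl^ b (rotl^ a u) ∎
  where open ≡-Reasoning

rotl^-++ : ∀ xs ys → rotl^ (length xs) (xs ++ ys) ≡ ys ++ xs
rotl^-++ []       ys = sym (++-identityʳ ys)
rotl^-++ (x ∷ xs) ys = begin
  rotl^ (length xs) ((xs ++ ys) ++ [ x ]) ≡⟨ cong (rotl^ (length xs)) (++-assoc xs ys [ x ]) ⟩
  rotl^ (length xs) (xs ++ ys ++ [ x ])   ≡⟨ rotl^-++ xs (ys ++ [ x ]) ⟩
  (ys ++ [ x ]) ++ xs                     ≡⟨ ++-assoc ys [ x ] xs ⟩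
  ys ++ x ∷ xs                            ∎
  where open ≡-Reasoning

rotl^-length : ∀ u → rotl^ (length u) u ≡ u
rotl^-length u = trans (cong (rotl^ (length u)) (sym (++-identityʳ u))) (rotl^-++ u [])

rotl^-*-length : ∀ q u → rotl^ (q * length u) u ≡ u
rotl^-*-length zero    u = refl
rotl^-*-length (suc q) u = begin
  rotl^ (length u + q * length u) u        ≡⟨ rotl^-+ (length u) (q * length u) u ⟩
  rotl^ (q * length u) (rotl^ (length u) u) ≡⟨ cong (rotl^ (q * length u)) (rotl^-length u) ⟩
  rotl^ (q * length u) u                    ≡⟨ rotl^-*-length q u ⟩
  u                                         ∎
  where open ≡-Reasoning

rotl^-%-length : ∀ i x xs → rotl^ i (x ∷ xs) ≡ rotl^ (i % length (x ∷ xs)) (x ∷ xs)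
rotl^-%-length i x xs = begin
  rotl^ i u                             ≡⟨ cong (λ j → rotl^ j u) i≡[i/n]*n+i%n ⟩
  rotl^ ((i / n) * n + i % n) u         ≡⟨ rotl^-+ ((i / n) * n) (i % n) u ⟩
  rotl^ (i % n) (rotl^ ((i / n) * n) u) ≡⟨ cong (rotl^ (i % n)) (rotl^-*-length (i / n) u) ⟩
  rotl^ (i % n) u                       ∎
  where
  open ≡-Reasoning
  u = x ∷ xs
  n = length u
  i≡[i/n]*n+i%n : i ≡ (i / n) * n + i % n
  i≡[i/n]*n+i%n = trans (m≡m%n+[m/n]*n i n) (+-comm (i % n) _)

rotl^-[] : ∀ i → rotl^ i [] ≡ []
rotl^-[] zero    = refl
rotl^-[] (suc i) = rotl^-[] i

replicate-∷ʳ : ∀ n (a : ℕ) → replicate n a ++ [ a ] ≡ a ∷ replicate n a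
replicate-∷ʳ zero    a = refl
replicate-∷ʳ (suc n) a = cong (a ∷_) (replicate-∷ʳ n a)

reverse-replicate : ∀ n (a : ℕ) → reverse (replicate n a) ≡ replicate n a
reverse-replicate zero    a = refl
reverse-replicate (suc n) a = begin
  reverse (a ∷ replicate n a)      ≡⟨ unfold-reverse a (replicate n a) ⟩
  reverse (replicate n a) ++ [ a ] ≡⟨ cong (_++ [ a ]) (reverse-replicate n a) ⟩
  replicate n a ++ [ a ]           ≡⟨ replicate-∷ʳ n a ⟩
  a ∷ replicate n a                ∎
  where open ≡-Reasoning

rotl-replicate : ∀ n (a : ℕ) → rotl (replicate n a) ≡ replicate n a
rotl-replicate zero    a = refl
rotl-replicate (suc n) a = replicate-∷ʳ n a

rotl^-replicate : ∀ i n (a : ℕ) → rotl^ i (replicate n a) ≡ replicate n a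
rotl^-replicate zero    n a = refl
rotl^-replicate (suc i) n a = trans (cong (rotl^ i) (rotl-replicate n a)) (rotl^-replicate i n a)

rotl-injective : ∀ u v → rotl u ≡ rotl v → u ≡ v
rotl-injective []       []       _ = refl
rotl-injective []       (y ∷ ys) e with () ← ++-conicalʳ ys [ y ] (sym e)
rotl-injective (x ∷ xs) []       e with () ← ++-conicalʳ xs [ x ] e
rotl-injective (x ∷ xs) (y ∷ ys) e with refl , refl ← ∷ʳ-injective xs ys e = refl

Rot : Word → Word → Set
Rot u v = ∃[ i ] rotl^ i u ≡ v

Rot-refl : ∀ {u} → Rot u u
Rot-refl = 0 , refl

Rot-trans : ∀ {u v w} → Rot u v → Rot v w → Rot u w
Rot-trans {u} (i , refl) (j , refl) = i + j , rotl^-+ i j u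

Rot-sym : ∀ {u v} → Rot u v → Rot v u
Rot-sym {[]}     (i , refl) = 0 , rotl^-[] i
Rot-sym {x ∷ xs} (i , refl) = i * length xs , (begin
  rotl^ (i * length xs) (rotl^ i u) ≡⟨ rotl^-+ i (i * length xs) u ⟨
  rotl^ (i + i * length xs) u       ≡⟨ cong (λ j → rotl^ j u) (*-suc i (length xs)) ⟨
  rotl^ (i * length u) u            ≡⟨ rotl^-*-length i u ⟩
  u                                 ∎)
  where
  open ≡-Reasoning
  u = x ∷ xs

rotl^-fixes-Rot : ∀ q {u v} → rotl^ q u ≡ u → Rot u v → rotl^ q v ≡ v
rotl^-fixes-Rot q {u} fix (j , refl) = trans (rotl^-comm q j u) (cong (rotl^ j) fix)

-- Key-words
rotationColexLeq : Word → ℕ → Bool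
rotationColexLeq u i = colexLeq (rotl^ i u) u

isKey≡all : ∀ u → isKey u ≡ all (rotationColexLeq u) (upTo (length u))
isKey≡all u = sym (foldr-map _∧_ (rotationColexLeq u) true (upTo (length u)))

isKey-colexMax : ∀ {u v} → T (isKey u) → Rot u v → T (colexLeq v u)
isKey-colexMax {[]}     _   (i , refl) rewrite rotl^-[] i = _
isKey-colexMax {x ∷ xs} key (i , refl) rewrite rotl^-%-length i x xs =
  applyUpTo⁻ id (length u) (all⁺ (rotationColexLeq u) (upTo (length u)) all-rotations) (m%n<n i _)
  where
  u = x ∷ xs
  all-rotations : T (all (rotationColexLeq u) (upTo (length u)))
  all-rotations = subst T (isKey≡all u) key

isKey-replicate : ∀ n → T (isKey (replicate n 0))
isKey-replicate n =
  subst T (sym (isKey≡all u)) (all⁻ (rotationColexLeq u) (applyUpTo⁺₂ id (length u) colex-refl))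
  where
  u = replicate n 0
  colex-refl : ∀ i → T (rotationColexLeq u i)
  colex-refl i rewrite rotl^-replicate i n 0 = lexLeq-refl (reverse u)

isKey-Rot-injective : ∀ {u v} → T (isKey u) → T (isKey v) → Rot u v → u ≡ v
isKey-Rot-injective {u} {v} key-u key-v u~v =
  colexLeq-antisym u v (isKey-colexMax key-v (Rot-sym u~v)) (isKey-colexMax key-u u~v)

padded : ℕ → ℕ → Word → Word
padded l s w = replicate l 0 ++ suc s ∷ w

cycleStart cycleEnd : ℕ → ℕ → Word → Word
cycleStart l s w = w ++ replicate l 0 ++ [ suc s ]
cycleEnd   l s w = suc s ∷ w ++ replicate l 0

cycleStart-∷ʳ : ∀ l s w → cycleStart l s w ≡ (w ++ replicate l 0) ++ [ suc s ]
cycleStart-∷ʳ l s w = sym (++-assoc w (replicate l 0) [ suc s ])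

HasNonzero : Word → Set
HasNonzero u = ∃[ l ] ∃[ s ] ∃[ w ] u ≡ padded l s w

replicate-or-HasNonzero : ∀ u → u ≡ replicate (length u) 0 ⊎ HasNonzero u
replicate-or-HasNonzero []          = inj₁ refl
replicate-or-HasNonzero (suc s ∷ w) = inj₂ (0 , s , w , refl)
replicate-or-HasNonzero (zero ∷ u) with replicate-or-HasNonzero u
... | inj₁ e                  = inj₁ (cong (0 ∷_) e)
... | inj₂ (l , s , w , refl) = inj₂ (suc l , s , w , refl)

decomp-padded : ∀ l s w → decomp (padded l s w) ≡ just (l , s , w)
decomp-padded zero    s w = refl
decomp-padded (suc l) s w rewrite decomp-padded l s w = refl

decomp-replicate : ∀ n → decomp (replicate n 0) ≡ nothing
decomp-replicate zero = refl
decomp-replicate (suc n) rewrite decomp-replicate n = refl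

anchor-padded : ∀ l s w → anchor (padded l s w) ≡ s ∷ w ++ replicate l 0
anchor-padded l s w rewrite decomp-padded l s w = refl

Rot-cycleStart : ∀ l s w → Rot (padded l s w) (cycleStart l s w)
Rot-cycleStart l s w = length (replicate l 0 ++ [ suc s ]) , (begin
  rotl^ (length zs) (padded l s w) ≡⟨ cong (rotl^ (length zs)) (++-assoc (replicate l 0) [ suc s ] w) ⟨
  rotl^ (length zs) (zs ++ w)      ≡⟨ rotl^-++ zs w ⟩
  cycleStart l s w                 ∎)
  where
  open ≡-Reasoning
  zs = replicate l 0 ++ [ suc s ]

anchor-Rot : ∀ {u v} → HasNonzero u → HasNonzero v → anchor u ≡ anchor v → Rot u v
anchor-Rot (l , s , w , refl) (l₁ , s₁ , w₁ , refl) e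
  rewrite anchor-padded l s w | anchor-padded l₁ s₁ w₁
  with refl , same-tail ← ∷-injective e =
  Rot-trans (Rot-cycleStart l s w)
    (subst (λ z → Rot z (padded l₁ s w₁)) same-start (Rot-sym (Rot-cycleStart l₁ s w₁)))
  where
  same-start : cycleStart l₁ s w₁ ≡ cycleStart l s w
  same-start = begin
    cycleStart l₁ s w₁                  ≡⟨ cycleStart-∷ʳ l₁ s w₁ ⟩
    (w₁ ++ replicate l₁ 0) ++ [ suc s ] ≡⟨ cong (_++ [ suc s ]) same-tail ⟨
    (w ++ replicate l 0) ++ [ suc s ]   ≡⟨ cycleStart-∷ʳ l s w ⟨
    cycleStart l s w                    ∎
    where open ≡-Reasoning

-- Cycles
cycleOf-replicate : ∀ n → cycleOf (replicate n 0) ≡ [ replicate n 0 ]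
cycleOf-replicate n rewrite decomp-replicate n = refl

cycleOf-padded : ∀ l s w →
  cycleOf (padded l s w) ≡ applyUpTo (λ i → rotl^ i (cycleStart l s w)) (period (padded l s w))
cycleOf-padded l s w rewrite decomp-padded l s w = map-upTo _ (period (padded l s w))

minPer-fixes : ∀ u ps d → rotl^ d u ≡ u → rotl^ (minPer u ps d) u ≡ u
minPer-fixes u []       d fix = fix
minPer-fixes u (p ∷ ps) d fix with ≡-dec ℕ._≟_ (rotl^ p u) u
... | yes fix-p = fix-p
... | no  _     = minPer-fixes u ps d fix

minPer-lowerBound : ∀ {b} u ps d → All (b ≤_) ps → b ≤ d → b ≤ minPer u ps d
minPer-lowerBound u []       d []           b≤d = b≤d
minPer-lowerBound u (p ∷ ps) d (b≤p ∷ b≤ps) b≤d with ≡-dec ℕ._≟_ (rotl^ p u) u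
... | yes _ = b≤p
... | no  _ = minPer-lowerBound u ps d b≤ps b≤d

minPer-minimal : ∀ u s t d → d ≤ s + t →
  ∀ q → s ≤ q → q < minPer u (iterate suc s t) d → rotl^ q u ≢ u
minPer-minimal u s zero    d d≤s q s≤q q<d = λ _ →
  <-irrefl refl (<-≤-trans q<d (≤-trans d≤s (≤-trans (≤-reflexive (+-identityʳ s)) s≤q)))
minPer-minimal u s (suc t) d d≤s+t q s≤q q<m with ≡-dec ℕ._≟_ (rotl^ s u) u
... | yes _   = λ _ → <-irrefl refl (<-≤-trans q<m s≤q)
... | no  ¬fix with m≤n⇒m<n∨m≡n s≤q
...   | inj₁ s<q  = minPer-minimal u (suc s) t d (≤-trans d≤s+t (≤-reflexive (+-suc s t))) q s<q q<m
...   | inj₂ refl = ¬fix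

upTo-iterate : ∀ n → map suc (upTo n) ≡ iterate suc 1 n
upTo-iterate n = trans (map-upTo suc n) (applyUpTo-iterate suc 1 n (λ _ → refl))
  where
  applyUpTo-iterate : ∀ f s n → (∀ i → f i ≡ s + i) → applyUpTo f n ≡ iterate suc s n
  applyUpTo-iterate f s zero    f≗ = refl
  applyUpTo-iterate f s (suc n) f≗ = cong₂ _∷_ (trans (f≗ 0) (+-identityʳ s))
    (applyUpTo-iterate (λ i → f (suc i)) (suc s) n (λ i → trans (f≗ (suc i)) (+-suc s i)))

period-fixes : ∀ u → rotl^ (period u) u ≡ u
period-fixes u = minPer-fixes u (map suc (upTo (length u))) (length u) (rotl^-length u)

period-positive : ∀ u → 1 ≤ length u → 1 ≤ period u
period-positive u = minPer-lowerBound u (map suc (upTo (length u))) (length u)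
  (map⁺ (applyUpTo⁺₂ id (length u) (λ _ → s≤s z≤n)))

period-minimal : ∀ u q → 1 ≤ q → q < period u → rotl^ q u ≢ u
period-minimal u q 1≤q q<p = minPer-minimal u 1 (length u) (length u) (n≤1+n _) q 1≤q
  (subst (λ ps → q < minPer u ps (length u)) (upTo-iterate (length u)) q<p)

1≤length-padded : ∀ l s w → 1 ≤ length (padded l s w)
1≤length-padded zero    s w = s≤s z≤n
1≤length-padded (suc l) s w = s≤s z≤n

cycleOf-padded-shape : ∀ l s w → ∃[ p ]
    cycleOf (padded l s w) ≡ applyUpTo (λ i → rotl^ i (cycleStart l s w)) (suc p)
  × rotl^ (suc p) (cycleStart l s w) ≡ cycleStart l s w
  × (∀ i → suc i < suc p → rotl^ (suc i) (cycleStart l s w) ≢ cycleStart l s w)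
cycleOf-padded-shape l s w
  with period (padded l s w) | period-positive u (1≤length-padded l s w)
     | period-fixes u | period-minimal u | cycleOf-padded l s w
  where u = padded l s w
... | suc p | _ | fix | minimal | shape =
  p , shape , rotl^-fixes-Rot (suc p) fix (Rot-cycleStart l s w) ,
  λ i i<p fix-i → minimal (suc i) (s≤s z≤n) i<p
                    (rotl^-fixes-Rot (suc i) fix-i (Rot-sym (Rot-cycleStart l s w)))

lastD-applyUpTo : ∀ d (f : ℕ → Word) n → lastD d (applyUpTo f (suc n)) ≡ f n
lastD-applyUpTo d f zero    = refl
lastD-applyUpTo d f (suc n) = lastD-applyUpTo (f 0) (λ i → f (suc i)) n

Rot-headD-cycleOf : ∀ u → Rot u (headD [] (cycleOf u))
Rot-headD-cycleOf u with replicate-or-HasNonzero u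
... | inj₁ e rewrite e | cycleOf-replicate (length u) = Rot-refl
... | inj₂ (l , s , w , refl) with p , shape , _ ← cycleOf-padded-shape l s w
  rewrite shape = Rot-cycleStart l s w

lastD-cycleOf-padded : ∀ l s w → lastD [] (cycleOf (padded l s w)) ≡ cycleEnd l s w
lastD-cycleOf-padded l s w with p , shape , fix , _ ← cycleOf-padded-shape l s w
  rewrite shape | lastD-applyUpTo [] (λ i → rotl^ i (cycleStart l s w)) p =
  rotl-injective _ _ (begin
    rotl (rotl^ p start)              ≡⟨ rotl^-comm 1 p start ⟩
    rotl^ (suc p) start               ≡⟨ fix ⟩
    start                             ≡⟨ cycleStart-∷ʳ l s w ⟩
    (w ++ replicate l 0) ++ [ suc s ] ∎)
  where
  open ≡-Reasoning
  start = cycleStart l s w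

data Adjacent (x y : Word) : List Word → Set where
  here  : ∀ {zs} → head zs ≡ just y → Adjacent x y (x ∷ zs)
  there : ∀ {z zs} → Adjacent x y zs → Adjacent x y (z ∷ zs)

ImmSucc⇒Adjacent : ∀ {x y zs} → ImmSucc x y zs → Adjacent x y zs
ImmSucc⇒Adjacent ([]      , post , refl) = here refl
ImmSucc⇒Adjacent (z ∷ pre , post , refl) = there (ImmSucc⇒Adjacent (pre , post , refl))

Adjacent-++⁻ : ∀ {x y} z zs bs → Adjacent x y ((z ∷ zs) ++ bs) →
  Adjacent x y (z ∷ zs) ⊎ Adjacent x y bs ⊎ head bs ≡ just y
Adjacent-++⁻ z []        bs (here e)  = inj₂ (inj₂ e)
Adjacent-++⁻ z []        bs (there a) = inj₂ (inj₁ a)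
Adjacent-++⁻ z (_ ∷ zs)  bs (here e)  = inj₁ (here e)
Adjacent-++⁻ z (z₁ ∷ zs) bs (there a) with Adjacent-++⁻ z₁ zs bs a
... | inj₁ a₁ = inj₁ (there a₁)
... | inj₂ r  = inj₂ r

Adjacent-applyUpTo : ∀ {x y} (f : ℕ → Word) n → Adjacent x y (applyUpTo f n) →
  ∃[ i ] suc i < n × y ≡ f (suc i)
Adjacent-applyUpTo f (suc (suc n)) (here refl) = 0 , s≤s (s≤s z≤n) , refl
Adjacent-applyUpTo f (suc n)       (there a)
  with i , i<n , refl ← Adjacent-applyUpTo (λ i → f (suc i)) n a = suc i , s≤s i<n , refl

head-insertAfter : ∀ x ys zs → head (insertAfter x ys zs) ≡ head zs
head-insertAfter x ys []       = refl
head-insertAfter x ys (z ∷ zs) with ≡-dec ℕ._≟_ z x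
... | yes _ = refl
... | no  _ = refl

insertAfter-Adjacent : ∀ {x y} x₀ ys zs → Adjacent x y (insertAfter x₀ ys zs) →
  Adjacent x y zs ⊎ Adjacent x y (x₀ ∷ ys) ⊎ Adjacent x₀ y zs
insertAfter-Adjacent x₀ ys (z ∷ zs) a with ≡-dec ℕ._≟_ z x₀
insertAfter-Adjacent x₀ ys (z ∷ zs) a | yes refl with Adjacent-++⁻ z ys zs a
... | inj₁ a₁        = inj₂ (inj₁ a₁)
... | inj₂ (inj₁ a₁) = inj₁ (there a₁)
... | inj₂ (inj₂ e)  = inj₂ (inj₂ (here e))
insertAfter-Adjacent x₀ ys (z ∷ zs) (here e) | no _ =
  inj₁ (here (trans (sym (head-insertAfter x₀ ys zs)) e))
insertAfter-Adjacent x₀ ys (z ∷ zs) (there a) | no _ with insertAfter-Adjacent x₀ ys zs a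
... | inj₁ a₁        = inj₁ (there a₁)
... | inj₂ (inj₁ a₁) = inj₂ (inj₁ a₁)
... | inj₂ (inj₂ a₁) = inj₂ (inj₂ (there a₁))

Adjacent-anchor-cycleOf : ∀ {u x y} → HasNonzero u → Adjacent x y (anchor u ∷ cycleOf u) →
  Rot u y × (y ≡ headD [] (cycleOf u) → x ≡ anchor u)
Adjacent-anchor-cycleOf (l , s , w , refl) a
  with p , shape , _ , minimal ← cycleOf-padded-shape l s w
  rewrite shape with a
... | here refl = Rot-cycleStart l s w , λ _ → refl
... | there a₁
  with i , i<p , refl ← Adjacent-applyUpTo (λ i → rotl^ i (cycleStart l s w)) (suc p) a₁ =
  Rot-trans (Rot-cycleStart l s w) (suc i , refl) , λ first → ⊥-elim (minimal i i<p first)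

-- Trailing zeros of key-words
LeadingNonzero : Word → Set
LeadingNonzero []          = ⊤
LeadingNonzero (zero ∷ _)  = ⊥
LeadingNonzero (suc _ ∷ _) = ⊤

replicate-++-injective : ∀ l l₁ {v v₁} → LeadingNonzero v → LeadingNonzero v₁ →
  replicate l 0 ++ v ≡ replicate l₁ 0 ++ v₁ → l ≡ l₁ × v ≡ v₁
replicate-++-injective zero    zero    _ _ e = refl , e
replicate-++-injective zero    (suc _) {[]}        _ _ ()
replicate-++-injective zero    (suc _) {suc _ ∷ _} _ _ ()
replicate-++-injective (suc _) zero    {v₁ = []}        _ _ ()
replicate-++-injective (suc _) zero    {v₁ = suc _ ∷ _} _ _ ()
replicate-++-injective (suc l) (suc l₁) nz nz₁ e
  with refl , refl ← replicate-++-injective l l₁ nz nz₁ (∷-injectiveʳ e) = refl , refl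

isKey-padded-LeadingNonzero : ∀ l s w → T (isKey (padded l s w)) → LeadingNonzero (reverse w)
isKey-padded-LeadingNonzero l s w key with reverse w in rev-w
... | []        = _
... | suc _ ∷ _ = _
... | zero ∷ r  = subst T start≤key-is-false (isKey-colexMax key (Rot-cycleStart l s w))
  where
  start≤key-is-false : colexLeq (cycleStart l s w) (padded l s w) ≡ false
  start≤key-is-false
    rewrite cycleStart-∷ʳ l s w | reverse-++ (w ++ replicate l 0) [ suc s ]
          | reverse-++ (replicate l 0) (suc s ∷ w) | unfold-reverse (suc s) w | rev-w = refl

reverse-++-replicate : ∀ l (w : Word) → reverse (w ++ replicate l 0) ≡ replicate l 0 ++ reverse w
reverse-++-replicate l w =
  trans (reverse-++ w (replicate l 0)) (cong (_++ reverse w) (reverse-replicate l 0))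

padded-tail-injective : ∀ {l l₁ w w₁} → LeadingNonzero (reverse w) → LeadingNonzero (reverse w₁) →
  w ++ replicate l 0 ≡ w₁ ++ replicate l₁ 0 → l ≡ l₁ × w ≡ w₁
padded-tail-injective {l} {l₁} {w} {w₁} nz nz₁ e
  with refl , rev-w ← replicate-++-injective l l₁ nz nz₁
         (trans (sym (reverse-++-replicate l w)) (trans (cong reverse e) (reverse-++-replicate l₁ w₁)))
  = refl , reverse-injective rev-w

cycleEnd≡anchor⇒bump : ∀ {l σ w l₁ s₁ w₁} →
  T (isKey (padded l σ w)) → T (isKey (padded l₁ s₁ w₁)) →
  cycleEnd l σ w ≡ anchor (padded l₁ s₁ w₁) → padded l₁ s₁ w₁ ≡ padded l (suc σ) w
cycleEnd≡anchor⇒bump {l} {σ} {w} {l₁} {s₁} {w₁} key key₁ e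
  rewrite anchor-padded l₁ s₁ w₁
  with refl , tail ← ∷-injective e
  with refl , refl ← padded-tail-injective {l} {l₁} {w} {w₁}
                       (isKey-padded-LeadingNonzero l σ w key)
                       (isKey-padded-LeadingNonzero l₁ s₁ w₁ key₁) tail = refl

concatMap-map≡cartesianProductWith : ∀ {A B C : Set} (f : A → B → C) xs ys →
  concatMap (λ x → map (f x) ys) xs ≡ cartesianProductWith f xs ys
concatMap-map≡cartesianProductWith f []       ys = refl
concatMap-map≡cartesianProductWith f (x ∷ xs) ys =
  cong (map (f x) ys ++_) (concatMap-map≡cartesianProductWith f xs ys)

lexWords-unique : ∀ n k → Unique (lexWords n k)
lexWords-unique zero    k = [] ∷ []
lexWords-unique (suc n) k =
  subst Unique (sym (concatMap-map≡cartesianProductWith _∷_ (upTo k) (lexWords n k)))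
    (Unique.cartesianProductWith⁺ _∷_ ∷-injective (Unique.upTo⁺ k) (lexWords-unique n k))

lexWords-length : ∀ n k {u} → u ∈ lexWords n k → length u ≡ n
lexWords-length zero    k (here refl) = refl
lexWords-length (suc n) k {u} u∈
  with _ , _ , _ , v∈ , refl ← ∈-cartesianProductWith⁻ _∷_ (upTo k) (lexWords n k)
         (subst (u ∈_) (concatMap-map≡cartesianProductWith _∷_ (upTo k) (lexWords n k)) u∈) =
  cong suc (lexWords-length n k v∈)

lexWords-head : ∀ n k → ∃[ r ] lexWords n (suc k) ≡ replicate n 0 ∷ r
lexWords-head zero    k = _ , refl
lexWords-head (suc n) k with r , eq ← lexWords-head n k rewrite eq = _ , refl

nth-∈ : ∀ xs {i} → i < length xs → nth [] xs i ∈ xs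
nth-∈ (x ∷ xs) {zero}  _         = here refl
nth-∈ (x ∷ xs) {suc i} (s≤s i<n) = there (nth-∈ xs i<n)

nth-injective : ∀ {xs} → Unique xs → ∀ {i j} → i < length xs → j < length xs →
  nth [] xs i ≡ nth [] xs j → i ≡ j
nth-injective {x ∷ xs} _            {zero}  {zero}  _         _         _ = refl
nth-injective {x ∷ xs} (x∉ ∷ _)     {zero}  {suc j} _         (s≤s j<n) e =
  ⊥-elim (All-lookup x∉ (nth-∈ xs j<n) e)
nth-injective {x ∷ xs} (x∉ ∷ _)     {suc i} {zero}  (s≤s i<n) _         e =
  ⊥-elim (All-lookup x∉ (nth-∈ xs i<n) (sym e))
nth-injective {x ∷ xs} (_ ∷ unique) {suc i} {suc j} (s≤s i<n) (s≤s j<n) e =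
  cong suc (nth-injective unique i<n j<n e)

module _ (n k : ℕ) where

  keys-unique : Unique (keys n k)
  keys-unique = Unique.filter⁺ (T? ∘ isKey) (Unique.map⁺ reverse-injective (lexWords-unique n k))

  key-∈-colexWords : ∀ {a} → a < c n k → key n k a ∈ colexWords n k × T (isKey (key n k a))
  key-∈-colexWords a<c = ∈-filter⁻ (T? ∘ isKey) {xs = colexWords n k} (nth-∈ (keys n k) a<c)

  key-isKey : ∀ {a} → a < c n k → T (isKey (key n k a))
  key-isKey a<c = proj₂ (key-∈-colexWords a<c)

  key-length : ∀ {a} → a < c n k → length (key n k a) ≡ n
  key-length a<c with u , u∈ , e ← ∈-map⁻ reverse (proj₁ (key-∈-colexWords a<c)) =
    trans (cong length e) (trans (length-reverse u) (lexWords-length n k u∈))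

  key-Rot-injective : ∀ {a b} → a < c n k → b < c n k → Rot (key n k a) (key n k b) → a ≡ b
  key-Rot-injective a<c b<c a~b =
    nth-injective keys-unique a<c b<c (isKey-Rot-injective (key-isKey a<c) (key-isKey b<c) a~b)

key-zero : ∀ n k → key n (suc k) 0 ≡ replicate n 0
key-zero n k with r , eq ← lexWords-head n k rewrite eq | reverse-replicate n 0 =
  cong (λ ks → nth [] ks 0) (filter-accept (T? ∘ isKey) (isKey-replicate n))

key-HasNonzero : ∀ n k {a} → 1 ≤ a → a < c n (suc k) → HasNonzero (key n (suc k) a)
key-HasNonzero n k {a} 1≤a a<c with replicate-or-HasNonzero (key n (suc k) a)
... | inj₂ nonzero = nonzero
... | inj₁ zeros = ⊥-elim (<-irrefl refl (subst (1 ≤_) a≡0 1≤a))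
  where
  a≡0 : a ≡ 0
  a≡0 = key-Rot-injective n (suc k) a<c (≤-<-trans z≤n a<c) (0 , (begin
    key n (suc k) a                          ≡⟨ zeros ⟩
    replicate (length (key n (suc k) a)) 0   ≡⟨ cong (λ m → replicate m 0) (key-length n (suc k) a<c) ⟩
    replicate n 0                            ≡⟨ key-zero n k ⟨
    key n (suc k) 0                          ∎))
    where open ≡-Reasoning

-- Successors in D_j
CycleSuccessor : ℕ → ℕ → ℕ → Word → Word → Set
CycleSuccessor n k j x y =
  ∃[ a ] 1 ≤ a × a ≤ j × Rot (key n k a) y × (y ≡ firstC n k a → x ≡ anchor (key n k a))

insertAfter-CycleSuccessor : ∀ n k j → suc j < c n (suc k) →
  (∀ {x y} → Adjacent x y (Dm n (suc k) j) → CycleSuccessor n (suc k) j x y) →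
  ∀ {x y} → Adjacent x y (Dm n (suc k) (suc j)) → CycleSuccessor n (suc k) (suc j) x y
insertAfter-CycleSuccessor n k j j<c ih {x} {y} adj
  with insertAfter-Adjacent (anchor (key n (suc k) (suc j))) (C n (suc k) (suc j)) (Dm n (suc k) j) adj
... | inj₁ old with a , 1≤a , a≤j , rot , first⇒anchor ← ih old =
  a , 1≤a , m≤n⇒m≤1+n a≤j , rot , first⇒anchor
... | inj₂ (inj₁ new) =
  suc j , s≤s z≤n , ≤-refl , Adjacent-anchor-cycleOf (key-HasNonzero n k (s≤s z≤n) j<c) new
... | inj₂ (inj₂ old) with a , 1≤a , a≤j , rot , first⇒anchor ← ih old =
  a , 1≤a , m≤n⇒m≤1+n a≤j , rot , λ first → ⊥-elim (<-irrefl refl (subst (_≤ j) (a≡new first) a≤j))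
  where
  a≡new : y ≡ firstC n (suc k) a → a ≡ suc j
  a≡new first = key-Rot-injective n (suc k) (<-trans (s≤s a≤j) j<c) j<c
    (anchor-Rot (key-HasNonzero n k 1≤a (<-trans (s≤s a≤j) j<c)) (key-HasNonzero n k (s≤s z≤n) j<c)
      (sym (first⇒anchor first)))

Dm-CycleSuccessor : ∀ n k j → j < c n (suc k) → ∀ {x y} →
  Adjacent x y (Dm n (suc k) j) → CycleSuccessor n (suc k) j x y
Dm-CycleSuccessor n k zero    _   (here ())
Dm-CycleSuccessor n k zero    _   (there ())
Dm-CycleSuccessor n k (suc j) j<c =
  insertAfter-CycleSuccessor n k j j<c (Dm-CycleSuccessor n k j (<-trans (n<1+n j) j<c))

m<n⇒n∸1<n : ∀ {m n} → m < n → n ∸ 1 < n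
m<n⇒n∸1<n {n = suc n} _ = n<1+n n

lemma4 : (n k m r l σ : ℕ) (w : Word) → 1 ≤ n → 1 ≤ k →
    m < c n k → r < c n k →
    key n k m ≡ replicate l 0 ++ (suc σ ∷ w) →
    ImmSucc (lastC n k m) (firstC n k r) (D n k) →
    key n k r ≡ replicate l 0 ++ (suc (suc σ) ∷ w)
lemma4 n (suc k) m r l σ w _ _ m<c r<c key-m last-first
  with a , 1≤a , a≤ , rot-a , first⇒anchor ←
         Dm-CycleSuccessor n k (c n (suc k) ∸ 1) (m<n⇒n∸1<n m<c) (ImmSucc⇒Adjacent last-first)
  with refl ← key-Rot-injective n (suc k) (≤-<-trans a≤ (m<n⇒n∸1<n m<c)) r<c
                (Rot-trans rot-a (Rot-sym (Rot-headD-cycleOf (key n (suc k) r))))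
  with l₁ , s₁ , w₁ , key-r ← key-HasNonzero n k 1≤a r<c =
  trans key-r (cycleEnd≡anchor⇒bump (subst (T ∘ isKey) key-m (key-isKey n (suc k) m<c))
                                    (subst (T ∘ isKey) key-r (key-isKey n (suc k) r<c)) end≡anchor)
  where
  end≡anchor : cycleEnd l σ w ≡ anchor (padded l₁ s₁ w₁)
  end≡anchor = begin
    cycleEnd l σ w                    ≡⟨ lastD-cycleOf-padded l σ w ⟨
    lastD [] (cycleOf (padded l σ w)) ≡⟨ cong (lastD [] ∘ cycleOf) key-m ⟨
    lastC n (suc k) m                 ≡⟨ first⇒anchor refl ⟩
    anchor (key n (suc k) r)          ≡⟨ cong anchor key-r ⟩
    anchor (padded l₁ s₁ w₁)          ∎
    where open ≡-Reasoning
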